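{- Let $\gamma$ be a scoring matrix for an alphabet $\Sigma$, let $Q$ be an integer, and let $s,t,u\in\Sigma^*$. Suppose that for each $a,b,c\in\Sigma$: (i) $\gamma(a,-)\le\gamma(a,b)+\gamma(b,-)$; (ii) $\gamma(-,a)\le\gamma(-,b)+\gamma(b,a)$; (iii) $\min\{\gamma(a,c),\gamma(a,-)+\gamma(-,c)\}\le\gamma(a,b)+\gamma(b,c)$; (iv) $\gamma(b,-)+\gamma(-,b)\ge Q$. Then for each alignment $A$ of $s,t$ and each alignment $B$ of $t,u$ there exist an alignment $C$ of $s,u$ and an integer $k\ge0$ such that $\mathrm{sc}_\gamma[A]+\mathrm{sc}_\gamma[B]\ge\mathrm{sc}_\gamma[C]+kQ$, $|A|\le|C|+k$, and $|B|\le|C|+k$.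
   Context: An alphabet $\Sigma$ is a finite nonempty set of symbols; $-$ denotes a gap symbol not in $\Sigma$, and $\Sigma_-=\Sigma\cup\{ -\}$. $\Sigma^*$ is the set of finite sequences over $\Sigma$. A scoring matrix $\gamma$ for $\Sigma$ assigns a real number $\gamma(x,y)$ to every pair $(x,y)\in\Sigma_-\times\Sigma_-$ with $(x,y)\neq(-,-)$. An alignment of $s,t\in\Sigma^*$ is a pair $[s',t']$ of sequences over $\Sigma_-$ of equal length obtained by inserting gap symbols into $s$ and into $t$, with no position $j$ having $s'(j)=t'(j)=-$; its length $|[s',t']|$ is $|s'|$, and its score is $\mathrm{sc}_\gamma[s',t']=\sum_j\gamma(s'(j),t'(j))$ (and $0$ when $s=t=\varepsilon$). -}

module Defs where

open import Level using (Level; suc; _⊔_)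
open import Data.Nat as ℕ using (ℕ)
open import Data.Integer as ℤ using (ℤ; +_; -[1+_])
open import Data.Fin using (Fin)
open import Data.Maybe using (Maybe; just; nothing)
open import Data.List using (List; []; _∷_; length)
open import Data.Product using (_×_; _,_)
open import Data.Sum using (_⊎_)
open import Relation.Binary.PropositionalEquality using (_≡_)
open import Relation.Nullary using (¬_)
open import Data.Unit using (⊤)
open import Data.Empty using (⊥)

-- The agda-stdlib has no real numbers, so the
-- scores are taken in an arbitrary totally ordered abelian group with a
-- distinguished positive unit `1#` (used to embed the integers, e.g. Q).
-- The reals (with 1#=1) are an instance of this structure.

record OrderedGroup (c ℓ : Level) : Set (suc (c ⊔ ℓ)) where
  infixl 6 _+_
  infix  4 _≤_
  field
    Carrier : Set c
    _+_     : Carrier → Carrier → Carrier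
    0#      : Carrier
    -_      : Carrier → Carrier
    1#      : Carrier
    _≤_     : Carrier → Carrier → Set ℓ
    +-assoc     : ∀ x y z → (x + y) + z ≡ x + (y + z)
    +-comm      : ∀ x y → x + y ≡ y + x
    +-identityˡ : ∀ x → 0# + x ≡ x
    -‿inverseˡ  : ∀ x → (- x) + x ≡ 0#
    ≤-refl      : ∀ {x} → x ≤ x
    ≤-trans     : ∀ {x y z} → x ≤ y → y ≤ z → x ≤ z
    ≤-antisym   : ∀ {x y} → x ≤ y → y ≤ x → x ≡ y
    ≤-total     : ∀ x y → (x ≤ y) ⊎ (y ≤ x)
    +-monoˡ-≤   : ∀ {x y} z → x ≤ y → x + z ≤ y + z
    0≤1         : 0# ≤ 1#
    0≢1         : ¬ (0# ≡ 1#)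

  nat : ℕ → Carrier
  nat ℕ.zero    = 0#
  nat (ℕ.suc n) = 1# + nat n

  int : ℤ → Carrier
  int (+ n)      = nat n
  int -[1+ n ]   = - nat (ℕ.suc n)

  -- "min{x , y} ≤ z" in a total order; literally x ≤ z or y ≤ z
  -- (the order is not assumed decidable, as for the reals, so min is
  -- not given as a function).
  MinLe : Carrier → Carrier → Carrier → Set ℓ
  MinLe x y z = (x ≤ z) ⊎ (y ≤ z)

-- Alphabet Σ = Fin (suc n) (finite, nonempty); Σ₋ = Maybe Σ with
-- `nothing` the gap symbol.

Σ : ℕ → Set
Σ n = Fin (ℕ.suc n)

Σ₋ : ℕ → Set
Σ₋ n = Maybe (Σ n)

-- A scoring matrix assigns a value to each pair (x , y) ≠ (- , -).
-- We represent it as a function on all pairs of Σ₋; the value at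
-- (nothing , nothing) is never used anywhere.
ScoringMatrix : ∀ {c ℓ} → OrderedGroup c ℓ → ℕ → Set c
ScoringMatrix R n = Σ₋ n → Σ₋ n → OrderedGroup.Carrier R

erase : ∀ {n} → List (Σ₋ n) → List (Σ n)
erase []             = []
erase (nothing ∷ xs) = erase xs
erase (just a ∷ xs)  = a ∷ erase xs

NoDoubleGap : ∀ {n} → List (Σ₋ n) → List (Σ₋ n) → Set
NoDoubleGap []               []        = ⊤
NoDoubleGap (nothing ∷ xs)   (nothing ∷ ys) = ⊥
NoDoubleGap (just _ ∷ xs)    (_ ∷ ys)  = NoDoubleGap xs ys
NoDoubleGap (nothing ∷ xs)   (just _ ∷ ys) = NoDoubleGap xs ys
NoDoubleGap []               (_ ∷ _)   = ⊥
NoDoubleGap (_ ∷ _)          []        = ⊥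

record Alignment {n : ℕ} (s t : List (Σ n)) : Set where
  constructor mkAlignment
  field
    top bot    : List (Σ₋ n)
    same-length : length top ≡ length bot
    no-gap-gap  : NoDoubleGap top bot
    erase-top   : erase top ≡ s
    erase-bot   : erase bot ≡ t

alen : ∀ {n} {s t : List (Σ n)} → Alignment s t → ℕ
alen A = length (Alignment.top A)

score-lists : ∀ {c ℓ} (R : OrderedGroup c ℓ) {n} → ScoringMatrix R n →
              List (Σ₋ n) → List (Σ₋ n) → OrderedGroup.Carrier R
score-lists R γ (x ∷ xs) (y ∷ ys) = γ x y + score-lists R γ xs ys
  where open OrderedGroup R
score-lists R γ _ _ = OrderedGroup.0# R

sc : ∀ {c ℓ} (R : OrderedGroup c ℓ) {n} → ScoringMatrix R n →
     {s t : List (Σ n)} → Alignment s t → OrderedGroup.Carrier R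
sc R γ A = score-lists R γ (Alignment.top A) (Alignment.bot A)

{-# OPTIONS --safe #-}
-- Walk along A and B in step, synchronised on the letters of t, emitting the columns of C.
-- A column of A or B with a gap in its t-row is copied into C. Two columns sharing a
-- letter b of t are replaced by columns of C of at most their combined score, by (i)-(iii),
-- except for the pair (-,b), (b,-): it is dropped, (iv) pays Q for it, and k counts these.
-- Every step adds at least as many columns to C, plus k, as it consumes from A or from B.
module Submission where

open import Defs
open import Level using (_⊔_)
open import Data.Nat using (ℕ)
open import Data.Integer using (ℤ)
open import Data.List using (List; []; _∷_; length)
open import Data.Maybe using (just; nothing)
open import Data.Product using (Σ-syntax; _×_; _,_)
open import Algebra.Bundles using (AbelianGroup)
open import Algebra.Consequences.Propositional using (comm∧idˡ⇒id; comm∧invˡ⇒inv)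
import Algebra.Properties.AbelianGroup as AbelianGroupProperties
import Algebra.Properties.CommutativeSemigroup as CommutativeSemigroupProperties
import Data.Nat as ℕ
import Data.Integer as ℤ
open import Data.Nat.Properties using (+-suc; m≤n⇒m≤1+n)
open import Data.Integer.Properties using ([1+m]⊖[1+n]≡m⊖n; suc-*)
open import Data.Sum using (inj₁; inj₂)
open import Data.Unit using (tt)
open import Relation.Binary.PropositionalEquality

module OrderedGroupProperties {c ℓ} (R : OrderedGroup c ℓ) where
  open OrderedGroup R
  open ≡-Reasoning

  +-abelianGroup : AbelianGroup c c
  +-abelianGroup = record
    { isAbelianGroup = record
      { isGroup = record
        { isMonoid = record
          { isSemigroup = record
            { isMagma = record { isEquivalence = isEquivalence ; ∙-cong = cong₂ _+_ }
            ; assoc   = +-assoc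
            }
          ; identity = comm∧idˡ⇒id +-comm +-identityˡ
          }
        ; inverse = comm∧invˡ⇒inv +-comm -‿inverseˡ
        ; ⁻¹-cong = cong -_
        }
      ; comm = +-comm
      }
    }

  open AbelianGroup +-abelianGroup using (identityʳ; inverseʳ; commutativeSemigroup)
  open AbelianGroupProperties +-abelianGroup using (ε⁻¹≈ε; ⁻¹-∙-comm)
  open CommutativeSemigroupProperties commutativeSemigroup using (interchange; x∙yz≈y∙xz; x∙yz≈yx∙z)

  nat-+ : ∀ m n → nat (m ℕ.+ n) ≡ nat m + nat n
  nat-+ ℕ.zero    n = sym (+-identityˡ (nat n))
  nat-+ (ℕ.suc m) n = trans (cong (1# +_) (nat-+ m n)) (sym (+-assoc 1# (nat m) (nat n)))

  int-⊖ : ∀ m n → int (m ℤ.⊖ n) ≡ nat m + - nat n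
  int-⊖ m         ℕ.zero    = sym (trans (cong (nat m +_) ε⁻¹≈ε) (identityʳ (nat m)))
  int-⊖ ℕ.zero    (ℕ.suc n) = sym (+-identityˡ _)
  int-⊖ (ℕ.suc m) (ℕ.suc n) = begin
    int (ℕ.suc m ℤ.⊖ ℕ.suc n)           ≡⟨ cong int ([1+m]⊖[1+n]≡m⊖n m n) ⟩
    int (m ℤ.⊖ n)                       ≡⟨ int-⊖ m n ⟩
    nat m + - nat n                     ≡⟨ +-identityˡ _ ⟨
    0# + (nat m + - nat n)              ≡⟨ cong (_+ (nat m + - nat n)) (inverseʳ 1#) ⟨
    (1# + - 1#) + (nat m + - nat n)     ≡⟨ interchange 1# (- 1#) (nat m) (- nat n) ⟩
    (1# + nat m) + (- 1# + - nat n)     ≡⟨ cong ((1# + nat m) +_) (⁻¹-∙-comm 1# (nat n)) ⟩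
    nat (ℕ.suc m) + - nat (ℕ.suc n)     ∎

  int-+ : ∀ i j → int (i ℤ.+ j) ≡ int i + int j
  int-+ (ℤ.+ m)    (ℤ.+ n)      = nat-+ m n
  int-+ (ℤ.+ m)    ℤ.-[1+ n ] = int-⊖ m (ℕ.suc n)
  int-+ ℤ.-[1+ m ] (ℤ.+ n)      = trans (int-⊖ n (ℕ.suc m)) (+-comm _ _)
  int-+ ℤ.-[1+ m ] ℤ.-[1+ n ] = begin
    - nat (ℕ.suc (ℕ.suc (m ℕ.+ n)))       ≡⟨ cong (λ k → - nat k) (+-suc (ℕ.suc m) n) ⟨
    - nat (ℕ.suc m ℕ.+ ℕ.suc n)           ≡⟨ cong -_ (nat-+ (ℕ.suc m) (ℕ.suc n)) ⟩
    - (nat (ℕ.suc m) + nat (ℕ.suc n))     ≡⟨ ⁻¹-∙-comm (nat (ℕ.suc m)) (nat (ℕ.suc n)) ⟨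
    - nat (ℕ.suc m) + - nat (ℕ.suc n)     ∎

  int-suc-* : ∀ k i → int (ℤ.+ ℕ.suc k ℤ.* i) ≡ int i + int (ℤ.+ k ℤ.* i)
  int-suc-* k i = trans (cong int (suc-* (ℤ.+ k) i)) (int-+ i (ℤ.+ k ℤ.* i))

  +-monoʳ-≤ : ∀ x {y z} → y ≤ z → x + y ≤ x + z
  +-monoʳ-≤ x {y} {z} y≤z = subst₂ _≤_ (+-comm y x) (+-comm z x) (+-monoˡ-≤ x y≤z)

  +-mono-≤ : ∀ {x y u v} → x ≤ y → u ≤ v → x + u ≤ y + v
  +-mono-≤ {y = y} {u} x≤y u≤v = ≤-trans (+-monoˡ-≤ u x≤y) (+-monoʳ-≤ y u≤v)

  ≤-interchange : ∀ {g x y S K P U} → g ≤ x + y → S + K ≤ P + U → (g + S) + K ≤ (x + P) + (y + U)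
  ≤-interchange {g} {x} {y} {S} {K} {P} {U} g≤ SK≤ =
    subst₂ _≤_ (sym (+-assoc g S K)) (interchange x y P U) (+-mono-≤ g≤ SK≤)

  ≤-interchange₂ : ∀ {g h x y S K P U} → g + h ≤ x + y → S + K ≤ P + U → (g + (h + S)) + K ≤ (x + P) + (y + U)
  ≤-interchange₂ {g} {h} {x} {y} {S} {K} {P} {U} gh≤ SK≤ =
    subst (λ w → w + K ≤ (x + P) + (y + U)) (+-assoc g h S) (≤-interchange gh≤ SK≤)

  ≤-interchangeˡ : ∀ {g S K P U} → S + K ≤ P + U → (g + S) + K ≤ (g + P) + U
  ≤-interchangeˡ {g} {S} {K} {P} {U} SK≤ =
    subst₂ _≤_ (sym (+-assoc g S K)) (sym (+-assoc g P U)) (+-monoʳ-≤ g SK≤)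

  ≤-interchangeʳ : ∀ {g S K P U} → S + K ≤ P + U → (g + S) + K ≤ P + (g + U)
  ≤-interchangeʳ {g} {S} {K} {P} {U} SK≤ =
    subst₂ _≤_ (sym (+-assoc g S K)) (x∙yz≈y∙xz g P U) (+-monoʳ-≤ g SK≤)

  ≤-interchange-moved : ∀ {q x y S K P U} → q ≤ x + y → S + K ≤ P + U → S + (q + K) ≤ (x + P) + (y + U)
  ≤-interchange-moved {q} {x} {y} {S} {K} {P} {U} q≤ SK≤ =
    subst (_≤ (x + P) + (y + U)) (sym (x∙yz≈yx∙z S q K)) (≤-interchange q≤ SK≤)

-- An alignment as its list of columns, indexed by the two sequences it aligns: composing
-- two scripts then synchronises on the shared sequence by unification, with no erase equations.
data EditScript {n : ℕ} : List (Σ n) → List (Σ n) → Set where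
  []    : EditScript [] []
  match : ∀ {s t} a b → EditScript s t → EditScript (a ∷ s) (b ∷ t)
  del   : ∀ {s t} a → EditScript s t → EditScript (a ∷ s) t
  ins   : ∀ {s t} b → EditScript s t → EditScript s (b ∷ t)

module _ {n : ℕ} where
  private
    variable
      s t : List (Σ n)

  top-row : EditScript s t → List (Σ₋ n)
  top-row []            = []
  top-row (match a _ E) = just a ∷ top-row E
  top-row (del a E)     = just a ∷ top-row E
  top-row (ins _ E)     = nothing ∷ top-row E

  bot-row : EditScript s t → List (Σ₋ n)
  bot-row []            = []
  bot-row (match _ b E) = just b ∷ bot-row E
  bot-row (del _ E)     = nothing ∷ bot-row E
  bot-row (ins b E)     = just b ∷ bot-row E

  length-top≡length-bot : (E : EditScript s t) → length (top-row E) ≡ length (bot-row E)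
  length-top≡length-bot []            = refl
  length-top≡length-bot (match _ _ E) = cong ℕ.suc (length-top≡length-bot E)
  length-top≡length-bot (del _ E)     = cong ℕ.suc (length-top≡length-bot E)
  length-top≡length-bot (ins _ E)     = cong ℕ.suc (length-top≡length-bot E)

  noDoubleGap : (E : EditScript s t) → NoDoubleGap (top-row E) (bot-row E)
  noDoubleGap []            = tt
  noDoubleGap (match _ _ E) = noDoubleGap E
  noDoubleGap (del _ E)     = noDoubleGap E
  noDoubleGap (ins _ E)     = noDoubleGap E

  erase-top-row : (E : EditScript s t) → erase (top-row E) ≡ s
  erase-top-row []            = refl
  erase-top-row (match a _ E) = cong (a ∷_) (erase-top-row E)
  erase-top-row (del a E)     = cong (a ∷_) (erase-top-row E)
  erase-top-row (ins _ E)     = erase-top-row E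

  erase-bot-row : (E : EditScript s t) → erase (bot-row E) ≡ t
  erase-bot-row []            = refl
  erase-bot-row (match _ b E) = cong (b ∷_) (erase-bot-row E)
  erase-bot-row (del _ E)     = erase-bot-row E
  erase-bot-row (ins b E)     = cong (b ∷_) (erase-bot-row E)

  toAlignment : EditScript s t → Alignment s t
  toAlignment E = mkAlignment (top-row E) (bot-row E)
    (length-top≡length-bot E) (noDoubleGap E) (erase-top-row E) (erase-bot-row E)

  fromRows : (xs ys : List (Σ₋ n)) → NoDoubleGap xs ys → erase xs ≡ s → erase ys ≡ t →
             Σ[ E ∈ EditScript s t ] top-row E ≡ xs × bot-row E ≡ ys
  fromRows []             []             _  refl refl = [] , refl , refl
  fromRows (just a ∷ xs)  (just b ∷ ys)  nd refl refl =
    let E , top≡ , bot≡ = fromRows xs ys nd refl refl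
    in  match a b E , cong (just a ∷_) top≡ , cong (just b ∷_) bot≡
  fromRows (just a ∷ xs)  (nothing ∷ ys) nd refl refl =
    let E , top≡ , bot≡ = fromRows xs ys nd refl refl
    in  del a E , cong (just a ∷_) top≡ , cong (nothing ∷_) bot≡
  fromRows (nothing ∷ xs) (just b ∷ ys)  nd refl refl =
    let E , top≡ , bot≡ = fromRows xs ys nd refl refl
    in  ins b E , cong (nothing ∷_) top≡ , cong (just b ∷_) bot≡
  fromRows (nothing ∷ _)  (nothing ∷ _)  ()
  fromRows []             (_ ∷ _)        ()
  fromRows (just _ ∷ _)   []             ()
  fromRows (nothing ∷ _)  []             ()

module Composition {c ℓ} (R : OrderedGroup c ℓ) {n : ℕ} (γ : ScoringMatrix R n) (Q : ℤ)
  (del-≤ : ∀ a b → OrderedGroup._≤_ R (γ (just a) nothing) (OrderedGroup._+_ R (γ (just a) (just b)) (γ (just b) nothing)))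
  (ins-≤ : ∀ a b → OrderedGroup._≤_ R (γ nothing (just a)) (OrderedGroup._+_ R (γ nothing (just b)) (γ (just b) (just a))))
  (match-≤ : ∀ a b c' → OrderedGroup.MinLe R (γ (just a) (just c')) (OrderedGroup._+_ R (γ (just a) nothing) (γ nothing (just c'))) (OrderedGroup._+_ R (γ (just a) (just b)) (γ (just b) (just c'))))
  (Q-≤ : ∀ b → OrderedGroup._≤_ R (OrderedGroup.int R Q) (OrderedGroup._+_ R (γ (just b) nothing) (γ nothing (just b))))
  where
  open OrderedGroup R
  open OrderedGroupProperties R

  score : {s t : List (Σ n)} → EditScript s t → Carrier
  score E = score-lists R γ (top-row E) (bot-row E)

  record Composite {s t u : List (Σ n)} (E : EditScript s t) (F : EditScript t u) : Set (c ⊔ ℓ) where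
    constructor composite
    field
      script    : EditScript s u
      cancelled : ℕ
      score-≤   : score script + int (ℤ.+ cancelled ℤ.* Q) ≤ score E + score F
      length-≤ˡ : length (top-row E) ℕ.≤ length (top-row script) ℕ.+ cancelled
      length-≤ʳ : length (top-row F) ℕ.≤ length (top-row script) ℕ.+ cancelled

  compose : {s t u : List (Σ n)} (E : EditScript s t) (F : EditScript t u) → Composite E F
  compose [] [] = composite [] 0 ≤-refl ℕ.z≤n ℕ.z≤n
  compose (del a E) F with compose E F
  ... | composite C k sc≤ l≤ r≤ =
    composite (del a C) k (≤-interchangeˡ sc≤) (ℕ.s≤s l≤) (m≤n⇒m≤1+n r≤)
  compose E (ins c F) with compose E F
  ... | composite C k sc≤ l≤ r≤ =
    composite (ins c C) k (≤-interchangeʳ sc≤) (m≤n⇒m≤1+n l≤) (ℕ.s≤s r≤)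
  compose (match a b E) (match _ c F) with compose E F | match-≤ a b c
  ... | composite C k sc≤ l≤ r≤ | inj₁ ac≤ =
    composite (match a c C) k (≤-interchange ac≤ sc≤) (ℕ.s≤s l≤) (ℕ.s≤s r≤)
  ... | composite C k sc≤ l≤ r≤ | inj₂ a-c≤ =
    composite (del a (ins c C)) k
      (≤-interchange₂ a-c≤ sc≤)
      (ℕ.s≤s (m≤n⇒m≤1+n l≤)) (ℕ.s≤s (m≤n⇒m≤1+n r≤))
  compose (match a b E) (del _ F) with compose E F
  ... | composite C k sc≤ l≤ r≤ =
    composite (del a C) k (≤-interchange (del-≤ a b) sc≤) (ℕ.s≤s l≤) (ℕ.s≤s r≤)
  compose (ins b E) (match _ c F) with compose E F
  ... | composite C k sc≤ l≤ r≤ =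
    composite (ins c C) k (≤-interchange (ins-≤ c b) sc≤) (ℕ.s≤s l≤) (ℕ.s≤s r≤)
  compose (ins b E) (del _ F) with compose E F
  ... | composite C k sc≤ l≤ r≤ =
    composite C (ℕ.suc k)
      (subst (λ w → score C + w ≤ _) (sym (int-suc-* k Q))
        (≤-interchange-moved (subst (int Q ≤_) (+-comm _ _) (Q-≤ b)) sc≤))
      (subst (ℕ.suc (length (top-row E)) ℕ.≤_) (sym (+-suc _ k)) (ℕ.s≤s l≤))
      (subst (ℕ.suc (length (top-row F)) ℕ.≤_) (sym (+-suc _ k)) (ℕ.s≤s r≤))

open import Data.Nat using (_≤_; _+_)
open import Data.Integer using (+_; _*_)

proposition1 : ∀ {c ℓ} (R : OrderedGroup c ℓ) {n : ℕ} (γ : ScoringMatrix R n) (Q : ℤ)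
    (s t u : List (Σ n)) →
    (∀ a b → OrderedGroup._≤_ R (γ (just a) nothing) (OrderedGroup._+_ R (γ (just a) (just b)) (γ (just b) nothing))) →
    (∀ a b → OrderedGroup._≤_ R (γ nothing (just a)) (OrderedGroup._+_ R (γ nothing (just b)) (γ (just b) (just a)))) →
    (∀ a b c' → OrderedGroup.MinLe R (γ (just a) (just c')) (OrderedGroup._+_ R (γ (just a) nothing) (γ nothing (just c'))) (OrderedGroup._+_ R (γ (just a) (just b)) (γ (just b) (just c')))) →
    (∀ b → OrderedGroup._≤_ R (OrderedGroup.int R Q) (OrderedGroup._+_ R (γ (just b) nothing) (γ nothing (just b)))) →
    (A : Alignment s t) (B : Alignment t u) →
    Σ[ C ∈ Alignment s u ] Σ[ k ∈ ℕ ]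
      (OrderedGroup._≤_ R (OrderedGroup._+_ R (sc R γ C) (OrderedGroup.int R (+ k * Q))) (OrderedGroup._+_ R (sc R γ A) (sc R γ B))
       × alen A ≤ alen C + k
       × alen B ≤ alen C + k)
proposition1 R γ Q s t u del-≤ ins-≤ match-≤ Q-≤
  (mkAlignment xs ys _ ndA xs→s ys→t) (mkAlignment ys′ zs _ ndB ys′→t zs→u)
  with fromRows xs ys ndA xs→s ys→t | fromRows ys′ zs ndB ys′→t zs→u
... | E , refl , refl | F , refl , refl =
  toAlignment script , cancelled , score-≤ , length-≤ˡ , length-≤ʳ
  where
  open Composition R γ Q del-≤ ins-≤ match-≤ Q-≤
  open Composite (compose E F)
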